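{- For every integer $q\ge 5$ there exists an $\mathcal{SOS}_q(2)$ of period \begin{align*} \tfrac{q(q-4)}{4} &\quad\text{if } q\equiv 0 \pmod 4,\\ \tfrac{(q+1)(q-1)}{4} &\quad\text{if } q\equiv 1 \pmod 4,\\ \tfrac{q(q-2)}{4} &\quad\text{if } q\equiv 2 \pmod 4,\\ \tfrac{(q+1)(q-3)}{4} &\quad\text{if } q\equiv 3 \pmod 4. \end{align*}
   Context: Sequences are periodic with entries in $\mathbb{Z}_q$, period $m$. Write $\mathbf{s}_n(i)=(s_i,\ldots,s_{i+n-1})$; $\mathbf{u}^R$ denotes the reverse and $-\mathbf{u}$ the entrywise negative of a tuple $\mathbf{u}$. An $\mathcal{SOS}_q(n)$ (special orientable sequence of order $n$) is a periodic sequence such that $\mathbf{s}_n(i)=\mathbf{s}_n(j)$ implies $i\equiv j\pmod m$, and for all $i,j$: $\mathbf{s}_n(i)\neq\mathbf{s}_n(j)^R$ and $\mathbf{s}_n(i)\neq-\mathbf{s}_n(j)^R$. -}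

module Defs where

open import Data.Nat using (ℕ; zero; suc; _+_; _*_; _∸_; _<_; NonZero)
open import Data.Nat.DivMod using (_%_; _/_)
open import Data.Fin using (Fin; toℕ; fromℕ<)
open import Data.Fin.Properties using ()
open import Data.Nat.DivMod using (m%n<n)
open import Data.Vec using (Vec; tabulate; reverse; map)
open import Relation.Binary.PropositionalEquality using (_≡_)
open import Relation.Nullary using (¬_)

negZ : (q : ℕ) .{{_ : NonZero q}} → Fin q → Fin q
negZ q x = fromℕ< (m%n<n (q ∸ toℕ x) q)

-- A periodic sequence of period m (m ≥ 1) over Z_q is given by one period
-- s : Fin m → Fin q, with s_i for i ∈ ℕ read as s (i mod m).
at : (m : ℕ) .{{_ : NonZero m}} {A : Set} → (Fin m → A) → ℕ → A
at m s i = s (fromℕ< (m%n<n i m))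

window : (m : ℕ) .{{_ : NonZero m}} {A : Set} → (Fin m → A) → (n : ℕ) → ℕ → Vec A n
window m s n i = tabulate (λ k → at m s (i + toℕ k))

IsSOS : (q m n : ℕ) .{{_ : NonZero q}} .{{_ : NonZero m}} → (Fin m → Fin q) → Set
IsSOS q m n s =
    (∀ i j → window m s n i ≡ window m s n j → i % m ≡ j % m)
  × (∀ i j → ¬ (window m s n i ≡ reverse (window m s n j)))
  × (∀ i j → ¬ (window m s n i ≡ map (negZ q) (reverse (window m s n j))))
  where open import Data.Product using (_×_)

sosPeriod : ℕ → ℕ
sosPeriod q with q % 4
... | 0 = (q * (q ∸ 4)) / 4
... | 1 = ((q + 1) * (q ∸ 1)) / 4
... | 2 = (q * (q ∸ 2)) / 4
... | _ = ((q + 1) * (q ∸ 3)) / 4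

{-# OPTIONS --safe #-}

-- Every entry of the sequence is a symbol: z = 0, p₁ b = 1 + b, p₂ k = 1 + u + k and
-- c = 2u + 1 (b, k < u), or the negative n₁ b, n₂ k of p₁ b, p₂ k. The positive symbols lie in
-- the lower half of ℤ_q, so a value determines its symbol. Consecutive entries always form a
-- step x ⇝ y, which runs forward around the cycle p₁ → p₂ → n₁ → n₂ → p₁ (possibly through z
-- or c). Negation exchanges pᵢ and nᵢ, so neither a reversed nor a negated reversed step is
-- again a step: this gives both orientability conditions. The sequence lists, for every shift
-- d < u and every b < u, the block p₁ b, p₂ (b + d), n₁ b, n₂ (b + d) (indices mod u), with z,
-- and c when q ≥ 4u + 3, inserted into the blocks of shift 0. A window determines b and d and
-- hence its position, so windows are distinct. The period is 4u² + 2u, or 4u² + 4u with c, and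
-- u = ⌊(q − 1)/4⌋ gives the stated values.

module Submission where

open import Data.Bool using (Bool; true; false; T; if_then_else_)
open import Data.Fin using (Fin; toℕ; fromℕ<)
open import Data.Fin.Properties using (toℕ-fromℕ<)
open import Data.Nat
open import Data.Nat.DivMod
open import Data.Nat.Divisibility using (divides-refl)
open import Data.Nat.Properties
open import Data.Nat.Tactic.RingSolver using (solve-∀)
open import Data.Product using (Σ; _×_; _,_; ∃₂; proj₁; proj₂)
open import Data.Sum using (inj₁; inj₂)
open import Data.Unit using (⊤; tt)
open import Data.Vec using ([]; _∷_; reverse; map)
open import Data.Vec.Properties using (∷-injective)
open import Function using (_∘_)
open import Relation.Binary.Definitions using (Asymmetric)
open import Relation.Binary.PropositionalEquality
open import Relation.Nullary using (¬_; yes; no; contradiction)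

open import Defs

[m+kn]/n≡k : ∀ {m n} k .{{_ : NonZero n}} → m < n → (m + k * n) / n ≡ k
[m+kn]/n≡k {m} k m<n =
  trans (+-distrib-/-∣ʳ m (divides-refl k)) (cong₂ _+_ (m<n⇒m/n≡0 m<n) (m*n/n≡m k _))

[m+kn]%n≡m : ∀ {m n} k .{{_ : NonZero n}} → m < n → (m + k * n) % n ≡ m
[m+kn]%n≡m {m} {n} k m<n = trans ([m+kn]%n≡m%n m k n) (m<n⇒m%n≡m m<n)

[1+m]%n≡[1+m%n]%n : ∀ m n .{{_ : NonZero n}} → suc m % n ≡ suc (m % n) % n
[1+m]%n≡[1+m%n]%n m n =
  trans (cong (λ k → suc k % n) (m≡m%n+[m/n]*n m n)) ([m+kn]%n≡m%n (suc (m % n)) (m / n) n)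

%-periodic-suc : ∀ {A : Set} (f : ℕ → A) m .{{_ : NonZero m}} → f m ≡ f 0 →
                 ∀ i → f (suc i % m) ≡ f (suc (i % m))
%-periodic-suc f m fm≡f0 i with m≤n⇒m<n∨m≡n (m%n<n i m)
... | inj₁ 1+i%m<m = cong f (trans ([1+m]%n≡[1+m%n]%n i m) (m<n⇒m%n≡m 1+i%m<m))
... | inj₂ 1+i%m≡m = begin
  f (suc i % m)        ≡⟨ cong f ([1+m]%n≡[1+m%n]%n i m) ⟩
  f (suc (i % m) % m)  ≡⟨ cong (λ j → f (j % m)) 1+i%m≡m ⟩
  f (m % m)            ≡⟨ cong f (n%n≡0 m) ⟩
  f 0                  ≡⟨ fm≡f0 ⟨
  f m                  ≡⟨ cong f 1+i%m≡m ⟨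
  f (suc (i % m))      ∎
  where open ≡-Reasoning

[m%n+o]%n≡[m+o]%n : ∀ m o n .{{_ : NonZero n}} → (m % n + o) % n ≡ (m + o) % n
[m%n+o]%n≡[m+o]%n m o n = begin
  (m % n + o) % n            ≡⟨ %-distribˡ-+ (m % n) o n ⟩
  (m % n % n + o % n) % n    ≡⟨ cong (λ k → (k + o % n) % n) (m%n%n≡m%n m n) ⟩
  (m % n + o % n) % n        ≡⟨ %-distribˡ-+ m o n ⟨
  (m + o) % n                ∎
  where open ≡-Reasoning

pair-injective : ∀ {A : Set} {x y x′ y′ : A} → x ∷ y ∷ [] ≡ x′ ∷ y′ ∷ [] → x ≡ x′ × y ≡ y′
pair-injective eq with ∷-injective eq
... | x≡x′ , tail≡ = x≡x′ , proj₁ (∷-injective tail≡)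

SOS₂ : (q m : ℕ) → Set
SOS₂ q m = Σ (NonZero q) λ nzq → Σ (NonZero m) λ nzm →
  Σ (Fin m → Fin q) λ s → IsSOS q m 2 {{nzq}} {{nzm}} s

module _ {q m : ℕ} .{{_ : NonZero q}} .{{_ : NonZero m}} (s : Fin m → Fin q) where

  window-2≡ : ∀ i → window m s 2 i ≡ at m s i ∷ at m s (suc i) ∷ []
  window-2≡ i = cong₂ (λ j k → at m s j ∷ at m s k ∷ []) (+-identityʳ i) (+-comm i 1)

  steps⇒IsSOS₂ : (Forward : Fin q → Fin q → Set) → Asymmetric Forward →
    (∀ {x y} → Forward x y → ¬ Forward (negZ q y) (negZ q x)) →
    (∀ i → Forward (at m s i) (at m s (suc i))) →
    (decode : Fin q → Fin q → ℕ) → (∀ i → decode (at m s i) (at m s (suc i)) ≡ i % m) →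
    IsSOS q m 2 s
  steps⇒IsSOS₂ Forward asym negZ-reverse forward decode decodes =
    distinct , no-reversal , no-negated-reversal
    where
    entries : ∀ {i x y} → window m s 2 i ≡ x ∷ y ∷ [] → at m s i ≡ x × at m s (suc i) ≡ y
    entries {i} eq = pair-injective (trans (sym (window-2≡ i)) eq)

    distinct : ∀ i j → window m s 2 i ≡ window m s 2 j → i % m ≡ j % m
    distinct i j eq with entries (trans eq (window-2≡ j))
    ... | x≡ , y≡ = begin
      i % m                                 ≡⟨ decodes i ⟨
      decode (at m s i) (at m s (suc i))    ≡⟨ cong₂ decode x≡ y≡ ⟩
      decode (at m s j) (at m s (suc j))    ≡⟨ decodes j ⟩
      j % m                                 ∎
      where open ≡-Reasoning

    no-reversal : ∀ i j → ¬ (window m s 2 i ≡ reverse (window m s 2 j))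
    no-reversal i j eq with entries (trans eq (cong reverse (window-2≡ j)))
    ... | x≡ , y≡ = asym (forward j) (subst₂ Forward x≡ y≡ (forward i))

    no-negated-reversal : ∀ i j → ¬ (window m s 2 i ≡ map (negZ q) (reverse (window m s 2 j)))
    no-negated-reversal i j eq with entries (trans eq (cong (map (negZ q) ∘ reverse) (window-2≡ j)))
    ... | x≡ , y≡ = negZ-reverse (forward j) (subst₂ Forward x≡ y≡ (forward i))

data Base : Set where
  one two : ℕ → Base
  mid     : Base

data Sym : Set where
  z       : Sym
  pos neg : Base → Sym

pattern p₁ b = pos (one b)
pattern p₂ k = pos (two k)
pattern n₁ b = neg (one b)
pattern n₂ k = neg (two k)
pattern c    = pos mid

negSym : Sym → Sym
negSym z       = z
negSym (pos t) = neg t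
negSym (neg t) = pos t

infix 4 _⇝_

data _⇝_ : Sym → Sym → Set where
  p₁⇝p₂ : ∀ {b k} → p₁ b ⇝ p₂ k
  p₂⇝n₁ : ∀ {k b} → p₂ k ⇝ n₁ b
  n₁⇝n₂ : ∀ {b k} → n₁ b ⇝ n₂ k
  n₂⇝p₁ : ∀ {k b} → n₂ k ⇝ p₁ b
  p₂⇝z  : ∀ {k} → p₂ k ⇝ z
  z⇝n₁  : ∀ {b} → z ⇝ n₁ b
  n₂⇝z  : ∀ {k} → n₂ k ⇝ z
  z⇝p₁  : ∀ {b} → z ⇝ p₁ b
  p₁⇝c  : ∀ {b} → p₁ b ⇝ c
  c⇝p₂  : ∀ {k} → c ⇝ p₂ k
  n₁⇝c  : ∀ {b} → n₁ b ⇝ c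
  c⇝n₂  : ∀ {k} → c ⇝ n₂ k

⇝-asym : Asymmetric _⇝_
⇝-asym p₁⇝p₂ ()
⇝-asym p₂⇝n₁ ()
⇝-asym n₁⇝n₂ ()
⇝-asym n₂⇝p₁ ()
⇝-asym p₂⇝z  ()
⇝-asym z⇝n₁  ()
⇝-asym n₂⇝z  ()
⇝-asym z⇝p₁  ()
⇝-asym p₁⇝c  ()
⇝-asym c⇝p₂  ()
⇝-asym n₁⇝c  ()
⇝-asym c⇝n₂  ()

⇝-negSym-reverse : ∀ {x y} → x ⇝ y → ¬ negSym y ⇝ negSym x
⇝-negSym-reverse p₁⇝p₂ ()
⇝-negSym-reverse p₂⇝n₁ ()
⇝-negSym-reverse n₁⇝n₂ ()
⇝-negSym-reverse n₂⇝p₁ ()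
⇝-negSym-reverse p₂⇝z  ()
⇝-negSym-reverse z⇝n₁  ()
⇝-negSym-reverse n₂⇝z  ()
⇝-negSym-reverse z⇝p₁  ()
⇝-negSym-reverse p₁⇝c  ()
⇝-negSym-reverse c⇝p₂  ()
⇝-negSym-reverse n₁⇝c  ()
⇝-negSym-reverse c⇝n₂  ()

ValidBase : ℕ → Bool → Base → Set
ValidBase u w (one b) = b < u
ValidBase u w (two k) = k < u
ValidBase u w mid     = T w

Valid : ℕ → Bool → Sym → Set
Valid u w z       = ⊤
Valid u w (pos t) = ValidBase u w t
Valid u w (neg t) = ValidBase u w t

negSym-valid : ∀ {u w} a → Valid u w a → Valid u w (negSym a)
negSym-valid z       _ = tt
negSym-valid (pos t) v = v
negSym-valid (neg t) v = v

height : ℕ → Base → ℕ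
height u (one b) = suc b
height u (two k) = suc (u + k)
height u mid     = suc (u + u)

module Encoding (u : ℕ) (w : Bool) (q : ℕ)
  (u*4<q : u * 4 < q) (mid-fits : T w → 2 + u * 4 < q) where

  instance
    q-nonZero : NonZero q
    q-nonZero = >-nonZero (≤-<-trans z≤n u*4<q)

  2u+2u<q : u + u + (u + u) < q
  2u+2u<q = subst (_< q) (u*4≡2u+2u u) u*4<q
    where
    u*4≡2u+2u : ∀ u → u * 4 ≡ u + u + (u + u)
    u*4≡2u+2u = solve-∀

  1+u+k≤2u : ∀ {k} → k < u → suc (u + k) ≤ u + u
  1+u+k≤2u {k} k<u = subst (_≤ u + u) (+-suc u k) (+-monoʳ-≤ u k<u)

  2*height<q : ∀ t → ValidBase u w t → height u t + height u t < q
  2*height<q (one b) b<u = ≤-<-trans (+-mono-≤ 1+b≤2u 1+b≤2u) 2u+2u<q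
    where
    1+b≤2u : suc b ≤ u + u
    1+b≤2u = ≤-trans b<u (m≤m+n u u)
  2*height<q (two k) k<u = ≤-<-trans (+-mono-≤ (1+u+k≤2u k<u) (1+u+k≤2u k<u)) 2u+2u<q
  2*height<q mid w-holds = subst (_< q) (2+u*4≡2[1+2u] u) (mid-fits w-holds)
    where
    2+u*4≡2[1+2u] : ∀ u → 2 + u * 4 ≡ suc (u + u) + suc (u + u)
    2+u*4≡2[1+2u] = solve-∀

  height<q∸height : ∀ t → ValidBase u w t → height u t < q ∸ height u t
  height<q∸height t v = m+n≤o⇒m≤o∸n (suc (height u t)) (2*height<q t v)

  height<q : ∀ t → ValidBase u w t → height u t < q
  height<q t v = ≤-<-trans (m≤m+n (height u t) (height u t)) (2*height<q t v)

  height>0 : ∀ t → 0 < height u t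
  height>0 (one _) = z<s
  height>0 (two _) = z<s
  height>0 mid     = z<s

  val : Sym → ℕ
  val z       = 0
  val (pos t) = height u t
  val (neg t) = q ∸ height u t

  val<q : ∀ a → Valid u w a → val a < q
  val<q z       _ = ≤-<-trans z≤n u*4<q
  val<q (pos t) v = height<q t v
  val<q (neg t) v = ∸-monoʳ-< (height>0 t) (<⇒≤ (height<q t v))

  parseBase : ℕ → Base
  parseBase v with v ≤? u
  ... | yes _ = one (v ∸ 1)
  ... | no _ with v ≤? u + u
  ...   | yes _ = two (v ∸ suc u)
  ...   | no _  = mid

  parseBase-height : ∀ t → ValidBase u w t → parseBase (height u t) ≡ t
  parseBase-height (one b) b<u with suc b ≤? u
  ... | yes _   = refl
  ... | no b≮u  = contradiction b<u b≮u
  parseBase-height (two k) k<u with suc (u + k) ≤? u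
  ... | yes u+k<u = contradiction u+k<u (<⇒≱ (s≤s (m≤m+n u k)))
  ... | no _ with suc (u + k) ≤? u + u
  ...   | yes _      = cong two (m+n∸m≡n u k)
  ...   | no u+k≮2u  = contradiction (1+u+k≤2u k<u) u+k≮2u
  parseBase-height mid _ with suc (u + u) ≤? u
  ... | yes 2u<u = contradiction 2u<u (<⇒≱ (s≤s (m≤m+n u u)))
  ... | no _ with suc (u + u) ≤? u + u
  ...   | yes 2u<2u = contradiction 2u<2u (<-irrefl refl)
  ...   | no _      = refl

  parse : ℕ → Sym
  parse v with v ≟ 0 | v <? q ∸ v
  ... | yes _ | _     = z
  ... | no _  | yes _ = pos (parseBase v)
  ... | no _  | no _  = neg (parseBase (q ∸ v))

  parse-val : ∀ a → Valid u w a → parse (val a) ≡ a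
  parse-val z _ = refl
  parse-val (pos t) v with height u t ≟ 0 | height u t <? q ∸ height u t
  ... | yes h≡0 | _     = contradiction h≡0 (n>0⇒n≢0 (height>0 t))
  ... | no _    | yes _ = cong pos (parseBase-height t v)
  ... | no _    | no h≮ = contradiction (height<q∸height t v) h≮
  parse-val (neg t) v with q ∸ height u t ≟ 0 | q ∸ height u t <? q ∸ (q ∸ height u t)
  ... | yes q∸h≡0 | _ = contradiction q∸h≡0 (n>0⇒n≢0 (m<n⇒0<n∸m (height<q t v)))
  ... | no _ | yes q∸h<q∸[q∸h] =
    contradiction (subst (q ∸ height u t <_) (m∸[m∸n]≡n (<⇒≤ (height<q t v))) q∸h<q∸[q∸h])
                  (<-asym (height<q∸height t v))
  ... | no _ | no _ =
    cong neg (trans (cong parseBase (m∸[m∸n]≡n (<⇒≤ (height<q t v)))) (parseBase-height t v))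

  val-negSym : ∀ a → Valid u w a → (q ∸ val a) % q ≡ val (negSym a)
  val-negSym z       _ = n%n≡0 q
  val-negSym (pos t) v = m<n⇒m%n≡m (val<q (neg t) v)
  val-negSym (neg t) v =
    trans (cong (_% q) (m∸[m∸n]≡n (<⇒≤ (height<q t v)))) (m<n⇒m%n≡m (height<q t v))

  record _encodes_ (x : Fin q) (a : Sym) : Set where
    constructor encoding
    field
      valid   : Valid u w a
      toℕ≡val : toℕ x ≡ val a

  symbol : Fin q → Sym
  symbol x = parse (toℕ x)

  symbol-encoded : ∀ {x a} → x encodes a → symbol x ≡ a
  symbol-encoded {a = a} (encoding va x≡a) = trans (cong parse x≡a) (parse-val a va)

  encodes-unique : ∀ {x a b} → x encodes a → x encodes b → a ≡ b
  encodes-unique xa xb = trans (sym (symbol-encoded xa)) (symbol-encoded xb)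

  negZ-encodes : ∀ {x a} → x encodes a → negZ q x encodes negSym a
  negZ-encodes {x} {a} (encoding va x≡a) = encoding (negSym-valid a va)
    (trans (toℕ-fromℕ< (m%n<n (q ∸ toℕ x) q))
           (trans (cong (λ v → (q ∸ v) % q) x≡a) (val-negSym a va)))

  Forward : Fin q → Fin q → Set
  Forward x y = ∃₂ λ a b → x encodes a × y encodes b × a ⇝ b

  Forward-asym : Asymmetric Forward
  Forward-asym (a , b , xa , yb , a⇝b) (b′ , a′ , yb′ , xa′ , b′⇝a′) =
    ⇝-asym a⇝b (subst₂ _⇝_ (encodes-unique yb′ yb) (encodes-unique xa′ xa) b′⇝a′)

  Forward-negZ-reverse : ∀ {x y} → Forward x y → ¬ Forward (negZ q y) (negZ q x)
  Forward-negZ-reverse (a , b , xa , yb , a⇝b) (b′ , a′ , yb′ , xa′ , b′⇝a′) =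
    ⇝-negSym-reverse a⇝b (subst₂ _⇝_ (encodes-unique yb′ (negZ-encodes yb))
                                     (encodes-unique xa′ (negZ-encodes xa)) b′⇝a′)

module Sequence (n : ℕ) where

  u : ℕ
  u = suc n

  ℓ : Bool → ℕ
  ℓ w = 6 + (if w then 2 else 0)

  leadRegion : Bool → ℕ
  leadRegion w = u * ℓ w

  period : Bool → ℕ
  period w = leadRegion w + n * u * 4

  _⊖_ : ℕ → ℕ → ℕ
  k ⊖ b = (k + (u ∸ b)) % u

  [a+b]%u⊖b≡a : ∀ {a b} → a < u → b ≤ u → ((a + b) % u) ⊖ b ≡ a
  [a+b]%u⊖b≡a {a} {b} a<u b≤u = begin
    ((a + b) % u + (u ∸ b)) % u  ≡⟨ [m%n+o]%n≡[m+o]%n (a + b) (u ∸ b) u ⟩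
    (a + b + (u ∸ b)) % u        ≡⟨ cong (_% u) (+-assoc a b (u ∸ b)) ⟩
    (a + (b + (u ∸ b))) % u      ≡⟨ cong (λ k → (a + k) % u) (m+[n∸m]≡n b≤u) ⟩
    (a + u) % u                  ≡⟨ [m+n]%n≡m%n a u ⟩
    a % u                        ≡⟨ m<n⇒m%n≡m a<u ⟩
    a                            ∎
    where open ≡-Reasoning

  b⊖b≡0 : ∀ {b} → b < u → b ⊖ b ≡ 0
  b⊖b≡0 {b} b<u = trans (cong (_⊖ b) (sym (m<n⇒m%n≡m b<u))) ([a+b]%u⊖b≡a z<s (<⇒≤ b<u))

  [1+b]%u⊖1≡b : ∀ {b} → b < u → (suc b % u) ⊖ 1 ≡ b
  [1+b]%u⊖1≡b {b} b<u = trans (cong (λ k → (k % u) ⊖ 1) (+-comm 1 b)) ([a+b]%u⊖b≡a b<u (s≤s z≤n))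

  -- Phase ℓ w of a lead block, and phase 4 of a shift block, is the first entry of the next block.
  leadBlock : (w : Bool) (b phase : ℕ) → Sym
  leadBlock false b 0 = p₁ b
  leadBlock false b 1 = p₂ b
  leadBlock false b 2 = z
  leadBlock false b 3 = n₁ b
  leadBlock false b 4 = n₂ b
  leadBlock false b 5 = z
  leadBlock true  b 0 = p₁ b
  leadBlock true  b 1 = c
  leadBlock true  b 2 = p₂ b
  leadBlock true  b 3 = z
  leadBlock true  b 4 = n₁ b
  leadBlock true  b 5 = c
  leadBlock true  b 6 = n₂ b
  leadBlock true  b 7 = z
  leadBlock _     b _ = p₁ (suc b % u)

  shiftBlock : (b k phase : ℕ) → Sym
  shiftBlock b k 0 = p₁ b
  shiftBlock b k 1 = p₂ k
  shiftBlock b k 2 = n₁ b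
  shiftBlock b k 3 = n₂ k
  shiftBlock b k _ = p₁ (suc b % u)

  shiftBlockAt : (block phase : ℕ) → Sym
  shiftBlockAt i = shiftBlock (i % u) ((suc (i / u) + i % u) % u)

  σ : Bool → ℕ → Sym
  σ w p with p <? leadRegion w
  ... | yes _ = leadBlock w (p / ℓ w) (p % ℓ w)
  ... | no _  = shiftBlockAt ((p ∸ leadRegion w) / 4) ((p ∸ leadRegion w) % 4)

  leadPos : (w : Bool) (b phase : ℕ) → ℕ
  leadPos w b t = t + b * ℓ w

  shiftPos : (w : Bool) (a b phase : ℕ) → ℕ
  shiftPos w a b t = leadRegion w + (t + (b + a * u) * 4)

  blockPos : (w : Bool) (leadPhase shiftPhase b shift : ℕ) → ℕ
  blockPos w e t b zero    = leadPos w b e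
  blockPos w e t b (suc a) = shiftPos w a b t

  -- The shift-0 steps p₁ b ⇝ p₂ b and n₁ b ⇝ n₂ b occur only when w = false.
  decode : Bool → Sym → Sym → ℕ
  decode w (p₁ b) (p₂ k)  = blockPos w 0 0 b (k ⊖ b)
  decode w (p₂ k) (n₁ b)  = shiftPos w (pred (k ⊖ b)) b 1
  decode w (n₁ b) (n₂ k)  = blockPos w 3 2 b (k ⊖ b)
  decode w (n₂ k) (p₁ b′) = shiftPos w (pred (k ⊖ (b′ ⊖ 1))) (b′ ⊖ 1) 3
  decode w (p₂ k) z       = leadPos w k (if w then 2 else 1)
  decode w z (n₁ b)       = leadPos w b (if w then 3 else 2)
  decode w (n₂ k) z       = leadPos w k (if w then 6 else 4)
  decode w z (p₁ b′)      = leadPos w (b′ ⊖ 1) (if w then 7 else 5)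
  decode w (p₁ b) c       = leadPos w b 0
  decode w c (p₂ k)       = leadPos w k 1
  decode w (n₁ b) c       = leadPos w b 4
  decode w c (n₂ k)       = leadPos w k 5
  decode w _ _            = 0

  DecodableStep : Bool → Sym → Sym → ℕ → Set
  DecodableStep w x y r = x ⇝ y × decode w x y ≡ r

  lead-step : ∀ w {b} t → b < u → t < ℓ w →
              DecodableStep w (leadBlock w b t) (leadBlock w b (suc t)) (leadPos w b t)
  lead-step false 0 b<u _ = p₁⇝p₂ , cong (blockPos false 0 0 _) (b⊖b≡0 b<u)
  lead-step false 1 _   _ = p₂⇝z , refl
  lead-step false 2 _   _ = z⇝n₁ , refl
  lead-step false 3 b<u _ = n₁⇝n₂ , cong (blockPos false 3 2 _) (b⊖b≡0 b<u)
  lead-step false 4 _   _ = n₂⇝z , refl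
  lead-step false 5 b<u _ = z⇝p₁ , cong (λ b → leadPos false b 5) ([1+b]%u⊖1≡b b<u)
  lead-step false (suc (suc (suc (suc (suc (suc _)))))) _ (s≤s (s≤s (s≤s (s≤s (s≤s (s≤s ()))))))
  lead-step true 0 _   _ = p₁⇝c , refl
  lead-step true 1 _   _ = c⇝p₂ , refl
  lead-step true 2 _   _ = p₂⇝z , refl
  lead-step true 3 _   _ = z⇝n₁ , refl
  lead-step true 4 _   _ = n₁⇝c , refl
  lead-step true 5 _   _ = c⇝n₂ , refl
  lead-step true 6 _   _ = n₂⇝z , refl
  lead-step true 7 b<u _ = z⇝p₁ , cong (λ b → leadPos true b 7) ([1+b]%u⊖1≡b b<u)
  lead-step true (suc (suc (suc (suc (suc (suc (suc (suc _)))))))) _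
    (s≤s (s≤s (s≤s (s≤s (s≤s (s≤s (s≤s (s≤s ()))))))))

  shift-step : ∀ w {a b} t → a < n → b < u → t < 4 →
    let k = (suc a + b) % u in
    DecodableStep w (shiftBlock b k t) (shiftBlock b k (suc t)) (shiftPos w a b t)
  shift-step w {a} {b} t a<n b<u = step t
    where
    k = (suc a + b) % u

    k⊖b≡1+a : k ⊖ b ≡ suc a
    k⊖b≡1+a = [a+b]%u⊖b≡a (s≤s a<n) (<⇒≤ b<u)

    step : ∀ t → t < 4 →
           DecodableStep w (shiftBlock b k t) (shiftBlock b k (suc t)) (shiftPos w a b t)
    step 0 _ = p₁⇝p₂ , cong (blockPos w 0 0 b) k⊖b≡1+a
    step 1 _ = p₂⇝n₁ , cong (λ d → shiftPos w (pred d) b 1) k⊖b≡1+a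
    step 2 _ = n₁⇝n₂ , cong (blockPos w 3 2 b) k⊖b≡1+a
    step 3 _ = n₂⇝p₁ , trans (cong (λ b′ → shiftPos w (pred (k ⊖ b′)) b′ 3) ([1+b]%u⊖1≡b b<u))
                             (cong (λ d → shiftPos w (pred d) b 3) k⊖b≡1+a)
    step (suc (suc (suc (suc _)))) (s≤s (s≤s (s≤s (s≤s ()))))

  leadBlock-start : ∀ w b → leadBlock w b 0 ≡ p₁ b
  leadBlock-start false b = refl
  leadBlock-start true  b = refl

  leadBlock-end : ∀ w b → leadBlock w b (ℓ w) ≡ p₁ (suc b % u)
  leadBlock-end false b = refl
  leadBlock-end true  b = refl

  σ-lead : ∀ w {b t} → b < u → t < ℓ w → σ w (leadPos w b t) ≡ leadBlock w b t
  σ-lead w {b} {t} b<u t<ℓ with leadPos w b t <? leadRegion w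
  ... | yes _ = cong₂ (leadBlock w) ([m+kn]/n≡k b t<ℓ) ([m+kn]%n≡m b t<ℓ)
  ... | no ≮L = contradiction (<-≤-trans (+-monoˡ-< (b * ℓ w) t<ℓ) (*-monoˡ-≤ (ℓ w) b<u)) ≮L

  σ-shift : ∀ w i {t} → t < 4 → σ w (leadRegion w + (t + i * 4)) ≡ shiftBlockAt i t
  σ-shift w i {t} t<4 with leadRegion w + (t + i * 4) <? leadRegion w
  ... | yes <L = contradiction <L (m+n≮m (leadRegion w) _)
  ... | no _ = trans (cong (λ r → shiftBlockAt (r / 4) (r % 4)) (m+n∸m≡n (leadRegion w) _))
                     (cong₂ shiftBlockAt ([m+kn]/n≡k i t<4) ([m+kn]%n≡m i t<4))

  σ-shiftPos : ∀ w {a b t} → b < u → t < 4 →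
               σ w (shiftPos w a b t) ≡ shiftBlock b ((suc a + b) % u) t
  σ-shiftPos w {a} {b} {t} b<u t<4 = trans (σ-shift w (b + a * u) t<4)
    (cong₂ (λ a′ b′ → shiftBlock b′ ((suc a′ + b′) % u) t) ([m+kn]/n≡k a b<u) ([m+kn]%n≡m a b<u))

  σ-lead-start : ∀ w {b} → b ≤ u → σ w (b * ℓ w) ≡ p₁ (b % u)
  σ-lead-start w {b} b≤u with m≤n⇒m<n∨m≡n b≤u
  ... | inj₁ b<u =
    trans (σ-lead w b<u z<s) (trans (leadBlock-start w b) (cong p₁ (sym (m<n⇒m%n≡m b<u))))
  ... | inj₂ refl = trans (cong (σ w) (sym (+-identityʳ (leadRegion w))))
                          (trans (σ-shift w 0 z<s) (cong p₁ (sym (n%n≡0 u))))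

  σ-lead-next : ∀ w {b t} → b < u → t < ℓ w → σ w (suc (leadPos w b t)) ≡ leadBlock w b (suc t)
  σ-lead-next w {b} {t} b<u t<ℓ with m≤n⇒m<n∨m≡n t<ℓ
  ... | inj₁ 1+t<ℓ = σ-lead w b<u 1+t<ℓ
  ... | inj₂ 1+t≡ℓ = begin
    σ w (suc t + b * ℓ w)    ≡⟨ cong (λ k → σ w (k + b * ℓ w)) 1+t≡ℓ ⟩
    σ w (suc b * ℓ w)        ≡⟨ σ-lead-start w b<u ⟩
    p₁ (suc b % u)           ≡⟨ leadBlock-end w b ⟨
    leadBlock w b (ℓ w)      ≡⟨ cong (leadBlock w b) 1+t≡ℓ ⟨
    leadBlock w b (suc t)    ∎
    where open ≡-Reasoning

  σ-shift-next : ∀ w {a b t} → b < u → t < 4 →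
                 σ w (suc (shiftPos w a b t)) ≡ shiftBlock b ((suc a + b) % u) (suc t)
  σ-shift-next w {a} {b} {t} b<u t<4 with m≤n⇒m<n∨m≡n t<4
  ... | inj₁ 1+t<4 = trans (cong (σ w) (sym (+-suc (leadRegion w) _))) (σ-shiftPos w b<u 1+t<4)
  ... | inj₂ refl  = trans (cong (σ w) (sym (+-suc (leadRegion w) _)))
    (trans (σ-shift w (suc (b + a * u)) z<s) (cong p₁ ([m+kn]%n≡m%n (suc b) a u)))

  σ-period : ∀ w → σ w (period w) ≡ σ w 0
  σ-period w = begin
    σ w (period w)     ≡⟨ σ-shift w (n * u) z<s ⟩
    p₁ (n * u % u)     ≡⟨ cong p₁ (m*n%n≡0 n u) ⟩
    p₁ 0               ≡⟨ leadBlock-start w 0 ⟨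
    leadBlock w 0 0    ≡⟨ σ-lead w z<s z<s ⟨
    σ w 0              ∎
    where open ≡-Reasoning

  data Position (w : Bool) : ℕ → Set where
    lead  : ∀ {b t} → b < u → t < ℓ w → Position w (leadPos w b t)
    shift : ∀ {a b t} → a < n → b < u → t < 4 → Position w (shiftPos w a b t)

  position : ∀ w {r} → r < period w → Position w r
  position w {r} r<m with r <? leadRegion w
  ... | yes r<L = subst (Position w) (sym (m≡m%n+[m/n]*n r (ℓ w)))
                        (lead (m<n*o⇒m/o<n r<L) (m%n<n r (ℓ w)))
  ... | no r≮L = subst (Position w) r≡ (shift a<n (m%n<n i u) (m%n<n r′ 4))
    where
    L  = leadRegion w
    r′ = r ∸ L
    i  = r′ / 4

    a<n : i / u < n
    a<n = m<n*o⇒m/o<n (m<n*o⇒m/o<n (subst (r′ <_) (m+n∸m≡n L _) (∸-monoˡ-< r<m (≮⇒≥ r≮L))))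

    r≡ : shiftPos w (i / u) (i % u) (r′ % 4) ≡ r
    r≡ = begin
      L + (r′ % 4 + (i % u + i / u * u) * 4)  ≡⟨ cong (λ j → L + (r′ % 4 + j * 4)) (m≡m%n+[m/n]*n i u) ⟨
      L + (r′ % 4 + i * 4)                    ≡⟨ cong (L +_) (m≡m%n+[m/n]*n r′ 4) ⟨
      L + r′                                  ≡⟨ m+[n∸m]≡n (≮⇒≥ r≮L) ⟩
      r                                       ∎
      where open ≡-Reasoning

  decodable-step : ∀ w {r} → r < period w → DecodableStep w (σ w r) (σ w (suc r)) r
  decodable-step w r<m with position w r<m
  ... | lead {b} {t} b<u t<ℓ = subst₂ (λ x y → DecodableStep w x y (leadPos w b t))
          (sym (σ-lead w b<u t<ℓ)) (sym (σ-lead-next w b<u t<ℓ)) (lead-step w t b<u t<ℓ)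
  ... | shift {a} {b} {t} a<n b<u t<4 = subst₂ (λ x y → DecodableStep w x y (shiftPos w a b t))
          (sym (σ-shiftPos w b<u t<4)) (sym (σ-shift-next w b<u t<4)) (shift-step w t a<n b<u t<4)

  leadBlock-valid : ∀ w {b} t → b < u → Valid u w (leadBlock w b t)
  leadBlock-valid false 0 b<u = b<u
  leadBlock-valid false 1 b<u = b<u
  leadBlock-valid false 2 _   = tt
  leadBlock-valid false 3 b<u = b<u
  leadBlock-valid false 4 b<u = b<u
  leadBlock-valid false 5 _   = tt
  leadBlock-valid false {b} (suc (suc (suc (suc (suc (suc _)))))) _ = m%n<n (suc b) u
  leadBlock-valid true 0 b<u = b<u
  leadBlock-valid true 1 _   = tt
  leadBlock-valid true 2 b<u = b<u
  leadBlock-valid true 3 _   = tt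
  leadBlock-valid true 4 b<u = b<u
  leadBlock-valid true 5 _   = tt
  leadBlock-valid true 6 b<u = b<u
  leadBlock-valid true 7 _   = tt
  leadBlock-valid true {b} (suc (suc (suc (suc (suc (suc (suc (suc _)))))))) _ = m%n<n (suc b) u

  shiftBlock-valid : ∀ {w b k} t → b < u → k < u → Valid u w (shiftBlock b k t)
  shiftBlock-valid 0 b<u _   = b<u
  shiftBlock-valid 1 _   k<u = k<u
  shiftBlock-valid 2 b<u _   = b<u
  shiftBlock-valid 3 _   k<u = k<u
  shiftBlock-valid {b = b} (suc (suc (suc (suc _)))) _ _ = m%n<n (suc b) u

  σ-valid : ∀ w p → Valid u w (σ w p)
  σ-valid w p with p <? leadRegion w
  ... | yes p<L = leadBlock-valid w (p % ℓ w) (m<n*o⇒m/o<n p<L)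
  ... | no _    = shiftBlock-valid (r′ % 4) (m%n<n i u) (m%n<n (suc (i / u) + i % u) u)
    where
    r′ = p ∸ leadRegion w
    i  = r′ / 4

module Construction (n : ℕ) (w : Bool) (q : ℕ)
  (u*4<q : suc n * 4 < q) (mid-fits : T w → 2 + suc n * 4 < q) where

  open Sequence n
  open Encoding u w q u*4<q mid-fits

  m : ℕ
  m = period w

  s : Fin m → Fin q
  s k = fromℕ< (val<q (σ w (toℕ k)) (σ-valid w (toℕ k)))

  at-encodes : ∀ i → at m s i encodes σ w (i % m)
  at-encodes i = encoding (σ-valid w (i % m))
    (trans (toℕ-fromℕ< _) (cong (val ∘ σ w) (toℕ-fromℕ< (m%n<n i m))))

  next-encodes : ∀ i → at m s (suc i) encodes σ w (suc (i % m))
  next-encodes i =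
    subst (at m s (suc i) encodes_) (%-periodic-suc (σ w) m (σ-period w) i) (at-encodes (suc i))

  isSOS : IsSOS q m 2 s
  isSOS = steps⇒IsSOS₂ s Forward Forward-asym Forward-negZ-reverse forward
            (λ x y → decode w (symbol x) (symbol y)) decodes
    where
    step : ∀ i → DecodableStep w (σ w (i % m)) (σ w (suc (i % m))) (i % m)
    step i = decodable-step w (m%n<n i m)

    forward : ∀ i → Forward (at m s i) (at m s (suc i))
    forward i = _ , _ , at-encodes i , next-encodes i , proj₁ (step i)

    decodes : ∀ i → decode w (symbol (at m s i)) (symbol (at m s (suc i))) ≡ i % m
    decodes i = trans (cong₂ (decode w) (symbol-encoded (at-encodes i))
                                        (symbol-encoded (next-encodes i)))
                      (proj₂ (step i))

sos₂-construction : ∀ n w {q} → suc n * 4 < q → (T w → 2 + suc n * 4 < q) →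
                    SOS₂ q (Sequence.period n w)
sos₂-construction n w u*4<q mid-fits = >-nonZero (≤-<-trans z≤n u*4<q) , _ , s , isSOS
  where open Construction n w _ u*4<q mid-fits

x*[y*4]/4≡ : ∀ x y {k} → x * y ≡ k → x * (y * 4) / 4 ≡ k
x*[y*4]/4≡ x y x*y≡k = trans (cong (_/ 4) (sym (*-assoc x y 4))) (trans (m*n/n≡m (x * y) 4) x*y≡k)

sos₂-of-residue : ∀ n w r x → 0 < r → (T w → 2 < r) → x * suc n ≡ Sequence.period n w →
                  SOS₂ (r + suc n * 4) (x * (suc n * 4) / 4)
sos₂-of-residue n w r x 0<r 2<r x*u≡period =
  subst (SOS₂ _) (sym (x*[y*4]/4≡ x (suc n) x*u≡period))
    (sos₂-construction n w (+-monoˡ-< (suc n * 4) 0<r)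
                           (λ w-holds → +-monoˡ-< (suc n * 4) (2<r w-holds)))

residue0-period : ∀ n → (4 + suc n * 4) * suc n ≡ suc n * 8 + n * suc n * 4
residue0-period = solve-∀

residue1-period : ∀ n → (1 + suc n * 4 + 1) * suc n ≡ suc n * 6 + n * suc n * 4
residue1-period = solve-∀

residue2-period : ∀ n → (2 + suc n * 4) * suc n ≡ suc n * 6 + n * suc n * 4
residue2-period = solve-∀

residue3-period : ∀ n → (3 + suc n * 4 + 1) * suc n ≡ suc n * 8 + n * suc n * 4
residue3-period = solve-∀

corollary3p10 : (q : ℕ) → 5 ≤ q →
    Σ (NonZero q) λ nzq → Σ (NonZero (sosPeriod q)) λ nzm →
      Σ (Fin (sosPeriod q) → Fin q) λ s →
        IsSOS q (sosPeriod q) 2 {{nzq}} {{nzm}} s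
corollary3p10 q 5≤q with q % 4 | q / 4 | m≡m%n+[m/n]*n q 4 | m%n<n q 4
... | 0 | suc (suc n) | refl | _ =
  sos₂-of-residue n true 4 (4 + suc n * 4) z<s (λ _ → s≤s (s≤s (s≤s z≤n))) (residue0-period n)
... | 1 | suc n | refl | _ =
  sos₂-of-residue n false 1 (1 + suc n * 4 + 1) z<s (λ ()) (residue1-period n)
... | 2 | suc n | refl | _ =
  sos₂-of-residue n false 2 (2 + suc n * 4) z<s (λ ()) (residue2-period n)
... | 3 | suc n | refl | _ =
  sos₂-of-residue n true 3 (3 + suc n * 4 + 1) z<s (λ _ → s≤s (s≤s (s≤s z≤n))) (residue3-period n)
... | 0 | 0 | refl | _ = contradiction 5≤q (λ ())
... | 0 | 1 | refl | _ = contradiction 5≤q (<⇒≱ ≤-refl)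
... | 1 | 0 | refl | _ = contradiction 5≤q (λ { (s≤s ()) })
... | 2 | 0 | refl | _ = contradiction 5≤q (λ { (s≤s (s≤s ())) })
... | 3 | 0 | refl | _ = contradiction 5≤q (λ { (s≤s (s≤s (s≤s ()))) })
... | suc (suc (suc (suc _))) | _ | _ | s≤s (s≤s (s≤s (s≤s ())))
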